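{- Let $K$ be a field of characteristic zero and let $\mathcal{DX}$ be the set of linear operators $Q\colon K[x]\to K[x]$ that have a DX-expansion $Q=\sum_{k=0}^\infty f_k(D)X^k$ with $f_k\in K[[t]]$ and the sum converging in the discrete topology. Then $\mathcal{DX}$ is a (noncommutative, unital) $K$-subalgebra of the algebra of all linear operators on $K[x]$ under composition, addition and scalar multiplication; in particular it is closed under composition.
   Context: $D$ is differentiation and $X$ multiplication by $x$; $f(D)=\sum_jc_jD^j$ for $f=\sum_jc_jt^j$. Convergence in the discrete topology means that for every polynomial $p$ only finitely many terms $f_k(D)X^kp$ are nonzero. -}

module Defs where

open import Level using (_⊔_)
open import Algebra.Bundles using (CommutativeRing; Semiring)
open import Data.Nat using (ℕ; zero; suc; _≤_)
open import Data.List using (List; []; _∷_; length; map)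
open import Data.Product using (Σ; _×_)
open import Relation.Nullary using (¬_)

IsField : ∀ {c ℓ} → CommutativeRing c ℓ → Set (c ⊔ ℓ)
IsField K = ¬ (1# ≈ 0#) × (∀ x → ¬ (x ≈ 0#) → Σ Carrier λ y → x * y ≈ 1#)
  where open CommutativeRing K

CharZero : ∀ {c ℓ} → CommutativeRing c ℓ → Set ℓ
CharZero K = ∀ n → ¬ (suc n ·ₙ 1# ≈ 0#)
  where
  open CommutativeRing K
  open import Algebra.Definitions.RawSemiring (Semiring.rawSemiring semiring) renaming (_×_ to _·ₙ_)

module DX {c ℓ} (K : CommutativeRing c ℓ) where
  open CommutativeRing K
  open import Algebra.Definitions.RawSemiring (Semiring.rawSemiring semiring) renaming (_×_ to _·ₙ_)

  -- K[x]: polynomials as coefficient lists (constant term first),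
  -- identified up to trailing zeros via _≈P_.
  Poly : Set c
  Poly = List Carrier

  coeff : Poly → ℕ → Carrier
  coeff []      _       = 0#
  coeff (a ∷ p) zero    = a
  coeff (a ∷ p) (suc i) = coeff p i

  _≈P_ : Poly → Poly → Set ℓ
  p ≈P q = ∀ i → coeff p i ≈ coeff q i

  zeroP : Poly
  zeroP = []

  _⊕_ : Poly → Poly → Poly
  []      ⊕ q       = q
  (a ∷ p) ⊕ []      = a ∷ p
  (a ∷ p) ⊕ (b ∷ q) = (a + b) ∷ (p ⊕ q)

  scale : Carrier → Poly → Poly
  scale c p = map (c *_) p

  Xop : Poly → Poly
  Xop p = 0# ∷ p

  dAux : ℕ → Poly → Poly
  dAux k []      = []
  dAux k (b ∷ q) = (k ·ₙ b) ∷ dAux (suc k) q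

  Dop : Poly → Poly
  Dop []      = []
  Dop (a ∷ p) = dAux 1 p

  iter : ℕ → (Poly → Poly) → Poly → Poly
  iter zero    F p = p
  iter (suc n) F p = F (iter n F p)

  sumP : ℕ → (ℕ → Poly) → Poly
  sumP zero    g = zeroP
  sumP (suc n) g = sumP n g ⊕ g n

  PowerSeries : Set c
  PowerSeries = ℕ → Carrier

  -- f(D) p = Σ_j f_j D^j p ; the terms with j ≥ length p vanish (D^j p = 0),
  -- so the sum is truncated there.
  applyPS : PowerSeries → Poly → Poly
  applyPS f p = sumP (length p) (λ j → scale (f j) (iter j Dop p))

  term : (ℕ → PowerSeries) → ℕ → Poly → Poly
  term f k p = applyPS (f k) (iter k Xop p)

  -- Q has a DX-expansion Σ_k f_k(D) X^k converging in the discrete topology: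
  -- for each p only finitely many terms are nonzero (all vanish from some N on),
  -- and Q p equals the (finite) sum of the terms.
  IsDX : (Poly → Poly) → Set (c ⊔ ℓ)
  IsDX Q = Σ (ℕ → PowerSeries) λ f → ∀ p → Σ ℕ λ N →
             (∀ k → N ≤ k → term f k p ≈P zeroP) × (Q p ≈P sumP N (λ k → term f k p))

  IsLinear : (Poly → Poly) → Set (c ⊔ ℓ)
  IsLinear Q = (∀ p q → p ≈P q → Q p ≈P Q q)
             × (∀ p q → Q (p ⊕ q) ≈P (Q p ⊕ Q q))
             × (∀ a p → Q (scale a p) ≈P scale a (Q p))

-- Everything is read on coefficient sequences, where f(D) acts by
-- (f(D) a)_i = ∑_j f_j (i+1)⋯(i+j) a_(i+j). Testing an expansion Q = ∑ f_k(D) X^k on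
-- x^L shows, after cancelling the nonzero integers (i+1)⋯(i+j) (characteristic zero),
-- that f_k has no terms of degree < k + L once k is large. The commutation rule
-- X h(D) = h(D) X − h′(D) expands X^k R = ∑_m G_{k,m}(D) X^m, where t^(m−k−r) divides
-- G_{k,m}. Then Q R = ∑_k f_k(D) X^k R = ∑_m (∑_k f_k G_{k,m})(D) X^m, and the two
-- vanishing properties make each coefficient of the inner sum finite and the outer
-- expansion convergent. The other closure properties have evident expansions, and
-- X D ≠ D X already on the constant 1.

module Submission where

open import Defs
open import Level using (_⊔_)
open import Algebra.Bundles using (CommutativeRing; Semiring)
open import Data.Nat using (ℕ; zero; suc; _≤_; _<_; z≤n; s≤s; s≤s⁻¹; NonZero)
  renaming (_+_ to _+ℕ_; _*_ to _*ℕ_; _∸_ to _∸ℕ_; _⊔_ to _⊔ℕ_)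
import Data.Nat.Properties as ℕ
open import Data.Fin using (toℕ)
open import Data.Fin.Properties using (toℕ<n; toℕ-inject₁; toℕ-fromℕ)
open import Data.List using ([]; _∷_; length)
open import Data.Product using (Σ; _×_; _,_; proj₁; proj₂)
open import Data.Sum using (inj₁; inj₂)
open import Function using (_∘_)
open import Relation.Nullary using (¬_; yes; no; contradiction)
open import Relation.Binary.PropositionalEquality as ≡ using (_≡_; _≢_)

-- rising i j = (i+1)(i+2)⋯(i+j), so that D^j x^(i+j) = rising i j · x^i.
rising : ℕ → ℕ → ℕ
rising i zero    = 1
rising i (suc j) = suc i *ℕ rising (suc i) j

module _ where
  open ≡.≡-Reasoning
  open import Data.Nat.Solver using (module +-*-Solver)
  open +-*-Solver

  rising-sucʳ : ∀ i j → rising i (suc j) ≡ rising i j *ℕ suc (i +ℕ j)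
  rising-sucʳ i zero    = solve 1 (λ i → (con 1 :+ i) :* con 1 := con 1 :* (con 1 :+ (i :+ con 0))) ≡.refl i
  rising-sucʳ i (suc j) = begin
    suc i *ℕ rising (suc i) (suc j)                  ≡⟨ ≡.cong (suc i *ℕ_) (rising-sucʳ (suc i) j) ⟩
    suc i *ℕ (rising (suc i) j *ℕ suc (suc i +ℕ j))  ≡⟨ ℕ.*-assoc (suc i) (rising (suc i) j) (suc (suc i +ℕ j)) ⟨
    rising i (suc j) *ℕ suc (suc i +ℕ j)             ≡⟨ ≡.cong (λ n → rising i (suc j) *ℕ suc n) (ℕ.+-suc i j) ⟨
    rising i (suc j) *ℕ suc (i +ℕ suc j)             ∎

  rising-pascal : ∀ i j → rising (suc i) (suc j) ≡ rising i (suc j) +ℕ suc j *ℕ rising (suc i) j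
  rising-pascal i j = begin
    rising (suc i) (suc j)                           ≡⟨ rising-sucʳ (suc i) j ⟩
    rising (suc i) j *ℕ suc (suc i +ℕ j)
      ≡⟨ solve 3 (λ R i j → R :* (con 2 :+ i :+ j) := (con 1 :+ i) :* R :+ (con 1 :+ j) :* R) ≡.refl (rising (suc i) j) i j ⟩
    rising i (suc j) +ℕ suc j *ℕ rising (suc i) j    ∎

  rising-+ : ∀ i j l → rising i j *ℕ rising (i +ℕ j) l ≡ rising i (j +ℕ l)
  rising-+ i zero    l = ≡.trans (ℕ.+-identityʳ _) (≡.cong (λ n → rising n l) (ℕ.+-identityʳ i))
  rising-+ i (suc j) l = begin
    suc i *ℕ rising (suc i) j *ℕ rising (i +ℕ suc j) l
      ≡⟨ ℕ.*-assoc (suc i) (rising (suc i) j) (rising (i +ℕ suc j) l) ⟩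
    suc i *ℕ (rising (suc i) j *ℕ rising (i +ℕ suc j) l)
      ≡⟨ ≡.cong (λ n → suc i *ℕ (rising (suc i) j *ℕ rising n l)) (ℕ.+-suc i j) ⟩
    suc i *ℕ (rising (suc i) j *ℕ rising (suc i +ℕ j) l)    ≡⟨ ≡.cong (suc i *ℕ_) (rising-+ (suc i) j l) ⟩
    rising i (suc j +ℕ l)                                    ∎

  b+[k+r]+L≡b+[k+[L+r]] : ∀ b k L r → b +ℕ (k +ℕ r) +ℕ L ≡ b +ℕ (k +ℕ (L +ℕ r))
  b+[k+r]+L≡b+[k+[L+r]] = solve 4 (λ b k L r → b :+ (k :+ r) :+ L := b :+ (k :+ (L :+ r))) ≡.refl

  max< : ℕ → (ℕ → ℕ) → ℕ
  max< zero    F = 0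
  max< (suc n) F = max< n F ⊔ℕ F n

  ≤-max< : ∀ n F k → k < n → F k ≤ max< n F
  ≤-max< (suc n) F k k<1+n with ℕ.m≤n⇒m<n∨m≡n (s≤s⁻¹ k<1+n)
  ... | inj₁ k<n      = ℕ.≤-trans (≤-max< n F k k<n) (ℕ.m≤m⊔n _ _)
  ... | inj₂ ≡.refl   = ℕ.m≤n⊔m _ _

  rising-nonZero : ∀ i j → NonZero (rising i j)
  rising-nonZero i zero    = _
  rising-nonZero i (suc j) = ℕ.m*n≢0 (suc i) (rising (suc i) j) {{_}} {{rising-nonZero (suc i) j}}

module DXOperators {c ℓ} (K : CommutativeRing c ℓ) where
  open CommutativeRing K
  open DX K
  open import Algebra.Definitions.RawSemiring (Semiring.rawSemiring semiring) renaming (_×_ to _·ₙ_)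
  open import Algebra.Properties.Semiring.Mult semiring using (×-homo-+; ×1-homo-*; ×-homo-1; ×-assoc-*; ×-congʳ)
  open import Algebra.Properties.AbelianGroup +-abelianGroup using (xyx⁻¹≈y)
  open import Algebra.Properties.Ring ring using (-1*x≈-x; [y-z]x≈yx-zx)
  import Algebra.Properties.Semiring.Sum semiring as Sum
  open import Algebra.Solver.Ring.NaturalCoefficients.Default commutativeSemiring using (solve; _:=_; _:+_; _:*_)
  open import Relation.Binary.Reasoning.Setoid setoid

  ι : ℕ → Carrier
  ι n = n ·ₙ 1#

  ι-cong : ∀ {m n} → m ≡ n → ι m ≈ ι n
  ι-cong ≡.refl = refl

  ·ₙ≈ι* : ∀ n x → n ·ₙ x ≈ ι n * x
  ·ₙ≈ι* n x = sym (trans (×-assoc-* n 1# x) (×-congʳ n (*-identityˡ x)))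

  x+z≈y⇒x≈y-z : ∀ {x y z} → x + z ≈ y → x ≈ y - z
  x+z≈y⇒x≈y-z {x} {y} {z} x+z≈y = trans (sym (xyx⁻¹≈y z x)) (+-congʳ (trans (+-comm z x) x+z≈y))

  x*[y*0]≈0 : ∀ x y {z} → z ≈ 0# → x * (y * z) ≈ 0#
  x*[y*0]≈0 x y z≈0 = trans (*-congˡ (trans (*-congˡ z≈0) (zeroʳ y))) (zeroʳ x)

  x*[0*z]≈0 : ∀ x {y} z → y ≈ 0# → x * (y * z) ≈ 0#
  x*[0*z]≈0 x z y≈0 = trans (*-congˡ (trans (*-congʳ y≈0) (zeroˡ z))) (zeroʳ x)

  opaque
    ∑< : ℕ → (ℕ → Carrier) → Carrier
    ∑< n F = Sum.sum {n} (F ∘ toℕ)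

  syntax ∑< n (λ k → e) = ∑[ k <ℕ n ] e

  opaque
    unfolding ∑<

    ∑-cong< : ∀ n {F G : ℕ → Carrier} → (∀ k → k < n → F k ≈ G k) → ∑< n F ≈ ∑< n G
    ∑-cong< n F≈G = Sum.sum-cong-≋ (λ i → F≈G (toℕ i) (toℕ<n i))

    ∑-cong : ∀ n {F G : ℕ → Carrier} → (∀ k → F k ≈ G k) → ∑< n F ≈ ∑< n G
    ∑-cong n F≈G = ∑-cong< n (λ k _ → F≈G k)

    ∑-zero : ∀ n {F : ℕ → Carrier} → (∀ k → k < n → F k ≈ 0#) → ∑< n F ≈ 0#
    ∑-zero n F≈0 = trans (∑-cong< n F≈0) (Sum.sum-replicate-zero n)

    ∑-init-last : ∀ n (F : ℕ → Carrier) → ∑< (suc n) F ≈ ∑< n F + F n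
    ∑-init-last n F = trans (Sum.sum-init-last {n} (F ∘ toℕ))
      (+-cong (Sum.sum-cong-≋ {n} (λ i → reflexive (≡.cong F (toℕ-inject₁ i)))) (reflexive (≡.cong F (toℕ-fromℕ n))))

    ∑-empty : ∀ (F : ℕ → Carrier) → ∑< 0 F ≈ 0#
    ∑-empty F = refl

    ∑-suc : ∀ n (F : ℕ → Carrier) → ∑< (suc n) F ≈ F 0 + ∑[ k <ℕ n ] F (suc k)
    ∑-suc n F = refl

    ∑-distrib-+ : ∀ n (F G : ℕ → Carrier) → ∑[ k <ℕ n ] (F k + G k) ≈ ∑< n F + ∑< n G
    ∑-distrib-+ n F G = Sum.∑-distrib-+ {n} (F ∘ toℕ) (G ∘ toℕ)

    *-distribˡ-∑ : ∀ n x (F : ℕ → Carrier) → x * ∑< n F ≈ ∑[ k <ℕ n ] (x * F k)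
    *-distribˡ-∑ n x F = Sum.*-distribˡ-sum {n} x (F ∘ toℕ)

    *-distribʳ-∑ : ∀ n x (F : ℕ → Carrier) → ∑< n F * x ≈ ∑[ k <ℕ n ] (F k * x)
    *-distribʳ-∑ n x F = Sum.*-distribʳ-sum {n} x (F ∘ toℕ)

    ∑-distrib-minus : ∀ n (F G : ℕ → Carrier) → ∑[ k <ℕ n ] (F k - G k) ≈ ∑< n F - ∑< n G
    ∑-distrib-minus n F G = begin
      ∑[ k <ℕ n ] (F k - G k)           ≈⟨ ∑-distrib-+ n F (λ k → - G k) ⟩
      ∑< n F + ∑[ k <ℕ n ] (- G k)      ≈⟨ +-congˡ (∑-cong n (λ k → sym (-1*x≈-x (G k)))) ⟩
      ∑< n F + ∑[ k <ℕ n ] (- 1# * G k) ≈⟨ +-congˡ (sym (*-distribˡ-∑ n (- 1#) G)) ⟩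
      ∑< n F + - 1# * ∑< n G            ≈⟨ +-congˡ (-1*x≈-x (∑< n G)) ⟩
      ∑< n F - ∑< n G                   ∎

    ∑-swap : ∀ m n (F : ℕ → ℕ → Carrier) → ∑[ a <ℕ m ] ∑[ b <ℕ n ] F a b ≈ ∑[ b <ℕ n ] ∑[ a <ℕ m ] F a b
    ∑-swap m n F = Sum.∑-comm {m} {n} (λ i j → F (toℕ i) (toℕ j))

    ∑-truncate : ∀ (F : ℕ → Carrier) {m} → (∀ k → m ≤ k → F k ≈ 0#) → ∀ n → m ≤ n → ∑< n F ≈ ∑< m F
    ∑-truncate F {zero} F≈0 n _ = ∑-zero n (λ k _ → F≈0 k z≤n)
    ∑-truncate F {suc m} F≈0 (suc n) (s≤s m≤n) =
      +-congˡ (∑-truncate (F ∘ suc) (λ k m≤k → F≈0 (suc k) (s≤s m≤k)) n m≤n)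

    ∑-truncate₂ : ∀ (F : ℕ → Carrier) {m n} → (∀ k → m ≤ k → F k ≈ 0#) → (∀ k → n ≤ k → F k ≈ 0#) →
                  ∑< m F ≈ ∑< n F
    ∑-truncate₂ F {m} {n} Fm≈0 Fn≈0 with ℕ.≤-total m n
    ... | inj₁ m≤n = sym (∑-truncate F Fm≈0 n m≤n)
    ... | inj₂ n≤m = ∑-truncate F Fn≈0 m n≤m

    ∑-single : ∀ n (F : ℕ → Carrier) j → j < n → (∀ k → k ≢ j → F k ≈ 0#) → ∑< n F ≈ F j
    ∑-single (suc n) F zero _ F≈0 = trans (+-congˡ (∑-zero n (λ k _ → F≈0 (suc k) (λ ())))) (+-identityʳ (F 0))
    ∑-single (suc n) F (suc j) (s≤s j<n) F≈0 =
      trans (+-congʳ (F≈0 0 (λ ()))) (trans (+-identityˡ _)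
        (∑-single n (F ∘ suc) j j<n (λ k k≢j → F≈0 (suc k) (k≢j ∘ ℕ.suc-injective))))

  -- Coefficient sequences and the action of f(D)

  Seq : Set c
  Seq = ℕ → Carrier

  infix 4 _≋_
  _≋_ : Seq → Seq → Set ℓ
  a ≋ b = ∀ n → a n ≈ b n

  shift : Seq → Seq
  shift a zero    = 0#
  shift a (suc n) = a n

  shift^ : ℕ → Seq → Seq
  shift^ zero    a = a
  shift^ (suc k) a = shift (shift^ k a)

  VanishesFrom : ℕ → Seq → Set ℓ
  VanishesFrom L a = ∀ n → L ≤ n → a n ≈ 0#

  -- f(D) on coefficient sequences, applying only the D^j with j < B; this loses nothing
  -- when a vanishes from B.
  actPS : PowerSeries → ℕ → Seq → Seq
  actPS f B a i = ∑[ j <ℕ B ] (f j * (ι (rising i j) * a (i +ℕ j)))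

  0ₛ : Seq
  0ₛ _ = 0#

  dxTerm : (ℕ → PowerSeries) → ℕ → ℕ → Seq → Seq
  dxTerm h k B a = actPS (h k) (k +ℕ B) (shift^ k a)

  dxSum : (ℕ → PowerSeries) → ℕ → ℕ → Seq → Seq
  dxSum h N B a i = ∑[ k <ℕ N ] dxTerm h k B a i

  vanishesFrom-mono : ∀ {a L L′} → VanishesFrom L a → L ≤ L′ → VanishesFrom L′ a
  vanishesFrom-mono a≈0 L≤L′ n L′≤n = a≈0 n (ℕ.≤-trans L≤L′ L′≤n)

  vanishesFrom-shift^ : ∀ k {a L} → VanishesFrom L a → VanishesFrom (k +ℕ L) (shift^ k a)
  vanishesFrom-shift^ zero    a≈0 = a≈0
  vanishesFrom-shift^ (suc k) a≈0 (suc n) (s≤s k+L≤n) = vanishesFrom-shift^ k a≈0 n k+L≤n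

  shift-cong : ∀ {a b} → a ≋ b → shift a ≋ shift b
  shift-cong a≋b zero    = refl
  shift-cong a≋b (suc n) = a≋b n

  shift^-cong : ∀ k {a b} → a ≋ b → shift^ k a ≋ shift^ k b
  shift^-cong zero    a≋b = a≋b
  shift^-cong (suc k) a≋b = shift-cong (shift^-cong k a≋b)

  shift^-+ : ∀ k a b → shift^ k (λ n → a n + b n) ≋ (λ n → shift^ k a n + shift^ k b n)
  shift^-+ zero    a b n       = refl
  shift^-+ (suc k) a b zero    = sym (+-identityʳ 0#)
  shift^-+ (suc k) a b (suc n) = shift^-+ k a b n

  shift^-* : ∀ k x a → shift^ k (λ n → x * a n) ≋ (λ n → x * shift^ k a n)
  shift^-* zero    x a n       = refl
  shift^-* (suc k) x a zero    = sym (zeroʳ x)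
  shift^-* (suc k) x a (suc n) = shift^-* k x a n

  shift-∑ : ∀ N (A : ℕ → Seq) → shift (λ n → ∑[ m <ℕ N ] A m n) ≋ (λ n → ∑[ m <ℕ N ] shift (A m) n)
  shift-∑ N A zero    = sym (∑-zero N (λ _ _ → refl))
  shift-∑ N A (suc n) = refl

  actPS-cong : ∀ f B {a b} → a ≋ b → actPS f B a ≋ actPS f B b
  actPS-cong f B a≋b i = ∑-cong B (λ j → *-congˡ (*-congˡ (a≋b (i +ℕ j))))

  actPS-congˡ : ∀ {f g} B a → (∀ j → j < B → f j ≈ g j) → actPS f B a ≋ actPS g B a
  actPS-congˡ B a f≈g i = ∑-cong< B (λ j j<B → *-congʳ (f≈g j j<B))

  actPS-truncate : ∀ f {a L} → VanishesFrom L a → ∀ B → L ≤ B → actPS f B a ≋ actPS f L a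
  actPS-truncate f a≈0 B L≤B i =
    ∑-truncate _ (λ j L≤j → x*[y*0]≈0 _ _ (a≈0 _ (ℕ.≤-trans L≤j (ℕ.m≤n+m j i)))) B L≤B

  actPS-zeroˡ : ∀ f B a → (∀ j → j < B → f j ≈ 0#) → actPS f B a ≋ 0ₛ
  actPS-zeroˡ f B a f≈0 i = ∑-zero B (λ j j<B → trans (*-congʳ (f≈0 j j<B)) (zeroˡ _))

  actPS-+ˡ : ∀ f g B a → actPS (λ j → f j + g j) B a ≋ (λ i → actPS f B a i + actPS g B a i)
  actPS-+ˡ f g B a i = trans (∑-cong B (λ j → distribʳ _ _ _)) (∑-distrib-+ B _ _)

  actPS-minusˡ : ∀ f g B a → actPS (λ j → f j - g j) B a ≋ (λ i → actPS f B a i - actPS g B a i)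
  actPS-minusˡ f g B a i = trans (∑-cong B (λ j → [y-z]x≈yx-zx _ _ _)) (∑-distrib-minus B _ _)

  actPS-*ˡ : ∀ x f B a → actPS (λ j → x * f j) B a ≋ (λ i → x * actPS f B a i)
  actPS-*ˡ x f B a i = trans (∑-cong B (λ j → *-assoc _ _ _)) (sym (*-distribˡ-∑ B x _))

  actPS-∑ˡ : ∀ N (F : ℕ → PowerSeries) B a →
             actPS (λ j → ∑[ k <ℕ N ] F k j) B a ≋ (λ i → ∑[ k <ℕ N ] actPS (F k) B a i)
  actPS-∑ˡ N F B a i = begin
    ∑[ j <ℕ B ] (∑[ k <ℕ N ] F k j * (ι (rising i j) * a (i +ℕ j)))   ≈⟨ ∑-cong B (λ j → *-distribʳ-∑ N _ (λ k → F k j)) ⟩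
    ∑[ j <ℕ B ] ∑[ k <ℕ N ] (F k j * (ι (rising i j) * a (i +ℕ j))) ≈⟨ ∑-swap B N _ ⟩
    ∑[ k <ℕ N ] actPS (F k) B a i                                   ∎

  actPS-+ʳ : ∀ f B a b → actPS f B (λ n → a n + b n) ≋ (λ i → actPS f B a i + actPS f B b i)
  actPS-+ʳ f B a b i = trans
    (∑-cong B (λ j → solve 4 (λ x y u v → x :* (y :* (u :+ v)) := x :* (y :* u) :+ x :* (y :* v)) refl _ _ _ _))
    (∑-distrib-+ B _ _)

  actPS-*ʳ : ∀ f B x a → actPS f B (λ n → x * a n) ≋ (λ i → x * actPS f B a i)
  actPS-*ʳ f B x a i = trans
    (∑-cong B (λ j → solve 4 (λ f r x u → f :* (r :* (x :* u)) := x :* (f :* (r :* u))) refl _ _ _ _))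
    (sym (*-distribˡ-∑ B x _))

  actPS-∑ʳ : ∀ N f B (A : ℕ → Seq) → actPS f B (λ n → ∑[ m <ℕ N ] A m n) ≋ (λ i → ∑[ m <ℕ N ] actPS f B (A m) i)
  actPS-∑ʳ N f B A i = begin
    ∑[ j <ℕ B ] (f j * (ι (rising i j) * ∑[ m <ℕ N ] A m (i +ℕ j)))   ≈⟨ ∑-cong B (λ j → *-congˡ (*-distribˡ-∑ N _ _)) ⟩
    ∑[ j <ℕ B ] (f j * ∑[ m <ℕ N ] (ι (rising i j) * A m (i +ℕ j)))   ≈⟨ ∑-cong B (λ j → *-distribˡ-∑ N _ _) ⟩
    ∑[ j <ℕ B ] ∑[ m <ℕ N ] (f j * (ι (rising i j) * A m (i +ℕ j))) ≈⟨ ∑-swap B N _ ⟩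
    ∑[ m <ℕ N ] actPS f B (A m) i                                   ∎

  dxTerm-+ˡ : ∀ f g k B a → dxTerm (λ k j → f k j + g k j) k B a ≋ (λ i → dxTerm f k B a i + dxTerm g k B a i)
  dxTerm-+ˡ f g k B a = actPS-+ˡ (f k) (g k) (k +ℕ B) (shift^ k a)

  dxTerm-*ˡ : ∀ x f k B a → dxTerm (λ k j → x * f k j) k B a ≋ (λ i → x * dxTerm f k B a i)
  dxTerm-*ˡ x f k B a = actPS-*ˡ x (f k) (k +ℕ B) (shift^ k a)

  dxSum-cong : ∀ h N B {a b} → a ≋ b → dxSum h N B a ≋ dxSum h N B b
  dxSum-cong h N B a≋b i = ∑-cong N (λ k → actPS-cong (h k) (k +ℕ B) (shift^-cong k a≋b) i)

  dxSum-+ : ∀ h N B a b → dxSum h N B (λ n → a n + b n) ≋ (λ i → dxSum h N B a i + dxSum h N B b i)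
  dxSum-+ h N B a b i = trans
    (∑-cong N (λ k → trans (actPS-cong (h k) (k +ℕ B) (shift^-+ k a b) i) (actPS-+ʳ (h k) (k +ℕ B) (shift^ k a) (shift^ k b) i)))
    (∑-distrib-+ N _ _)

  dxSum-* : ∀ h N B x a → dxSum h N B (λ n → x * a n) ≋ (λ i → x * dxSum h N B a i)
  dxSum-* h N B x a i = trans
    (∑-cong N (λ k → trans (actPS-cong (h k) (k +ℕ B) (shift^-* k x a) i) (actPS-*ʳ (h k) (k +ℕ B) x (shift^ k a) i)))
    (sym (*-distribˡ-∑ N x _))

  coeff-⊕ : ∀ p q → coeff (p ⊕ q) ≋ (λ i → coeff p i + coeff q i)
  coeff-⊕ []      q       i       = sym (+-identityˡ _)
  coeff-⊕ (a ∷ p) []      zero    = sym (+-identityʳ _)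
  coeff-⊕ (a ∷ p) []      (suc i) = sym (+-identityʳ _)
  coeff-⊕ (a ∷ p) (b ∷ q) zero    = refl
  coeff-⊕ (a ∷ p) (b ∷ q) (suc i) = coeff-⊕ p q i

  coeff-scale : ∀ x p → coeff (scale x p) ≋ (λ i → x * coeff p i)
  coeff-scale x []      i       = sym (zeroʳ x)
  coeff-scale x (a ∷ p) zero    = refl
  coeff-scale x (a ∷ p) (suc i) = coeff-scale x p i

  coeff-sumP : ∀ n g → coeff (sumP n g) ≋ (λ i → ∑[ k <ℕ n ] coeff (g k) i)
  coeff-sumP zero    g i = sym (∑-empty _)
  coeff-sumP (suc n) g i = begin
    coeff (sumP n g ⊕ g n) i                     ≈⟨ coeff-⊕ (sumP n g) (g n) i ⟩
    coeff (sumP n g) i + coeff (g n) i           ≈⟨ +-congʳ (coeff-sumP n g i) ⟩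
    ∑[ k <ℕ n ] coeff (g k) i + coeff (g n) i    ≈⟨ ∑-init-last n (λ k → coeff (g k) i) ⟨
    ∑[ k <ℕ suc n ] coeff (g k) i                ∎

  coeff-dAux : ∀ k q → coeff (dAux k q) ≋ (λ i → ι (k +ℕ i) * coeff q i)
  coeff-dAux k []      i       = sym (zeroʳ _)
  coeff-dAux k (b ∷ q) zero    = trans (·ₙ≈ι* k b) (*-congʳ (ι-cong (≡.sym (ℕ.+-identityʳ k))))
  coeff-dAux k (b ∷ q) (suc i) = trans (coeff-dAux (suc k) q i) (*-congʳ (ι-cong (≡.sym (ℕ.+-suc k i))))

  coeff-D : ∀ p → coeff (Dop p) ≋ (λ i → ι (suc i) * coeff p (suc i))
  coeff-D []      i = sym (zeroʳ _)
  coeff-D (a ∷ p) i = coeff-dAux 1 p i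

  coeff-D^ : ∀ j p → coeff (iter j Dop p) ≋ (λ i → ι (rising i j) * coeff p (i +ℕ j))
  coeff-D^ zero    p i =
    sym (trans (*-congʳ (×-homo-1 1#)) (trans (*-identityˡ _) (reflexive (≡.cong (coeff p) (ℕ.+-identityʳ i)))))
  coeff-D^ (suc j) p i = begin
    coeff (Dop (iter j Dop p)) i                                  ≈⟨ coeff-D (iter j Dop p) i ⟩
    ι (suc i) * coeff (iter j Dop p) (suc i)                      ≈⟨ *-congˡ (coeff-D^ j p (suc i)) ⟩
    ι (suc i) * (ι (rising (suc i) j) * coeff p (suc i +ℕ j))     ≈⟨ *-assoc _ _ _ ⟨
    (ι (suc i) * ι (rising (suc i) j)) * coeff p (suc i +ℕ j)
      ≈⟨ *-cong (sym (×1-homo-* (suc i) (rising (suc i) j))) (reflexive (≡.cong (coeff p) (≡.sym (ℕ.+-suc i j)))) ⟩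
    ι (rising i (suc j)) * coeff p (i +ℕ suc j)                   ∎

  coeff-X^ : ∀ k p i → coeff (iter k Xop p) i ≡ shift^ k (coeff p) i
  coeff-X^ zero    p i       = ≡.refl
  coeff-X^ (suc k) p zero    = ≡.refl
  coeff-X^ (suc k) p (suc i) = coeff-X^ k p i

  length-X^ : ∀ k p → length (iter k Xop p) ≡ k +ℕ length p
  length-X^ zero    p = ≡.refl
  length-X^ (suc k) p = ≡.cong suc (length-X^ k p)

  coeff-vanishesFrom-length : ∀ p → VanishesFrom (length p) (coeff p)
  coeff-vanishesFrom-length []      n       _         = refl
  coeff-vanishesFrom-length (a ∷ p) (suc n) (s≤s L≤n) = coeff-vanishesFrom-length p n L≤n

  coeff-applyPS : ∀ f p → coeff (applyPS f p) ≋ actPS f (length p) (coeff p)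
  coeff-applyPS f p i = trans (coeff-sumP (length p) _ i)
    (∑-cong (length p) (λ j → trans (coeff-scale (f j) (iter j Dop p) i) (*-congˡ (coeff-D^ j p i))))

  coeff-term : ∀ f k p → coeff (term f k p) ≋ actPS (f k) (k +ℕ length p) (shift^ k (coeff p))
  coeff-term f k p i = trans (coeff-applyPS (f k) (iter k Xop p) i)
    (≡.subst (λ B → actPS (f k) (length (iter k Xop p)) (coeff (iter k Xop p)) i ≈ actPS (f k) B (shift^ k (coeff p)) i)
      (length-X^ k p) (actPS-cong (f k) _ (λ n → reflexive (coeff-X^ k p n)) i))

  record HasExpansion (Q : Poly → Poly) (h : ℕ → PowerSeries) : Set (c ⊔ ℓ) where
    field
      order        : Poly → ℕ
      terms-vanish : ∀ p k → order p ≤ k → dxTerm h k (length p) (coeff p) ≋ 0ₛ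
      expansion    : ∀ p → coeff (Q p) ≋ dxSum h (order p) (length p) (coeff p)

    coeff-dxSum : ∀ p {N B} → order p ≤ N → length p ≤ B → coeff (Q p) ≋ dxSum h N B (coeff p)
    coeff-dxSum p {N} {B} order≤N L≤B i = begin
      coeff (Q p) i                            ≈⟨ expansion p i ⟩
      dxSum h (order p) (length p) (coeff p) i ≈⟨ ∑-truncate _ (λ k order≤k → terms-vanish p k order≤k i) N order≤N ⟨
      dxSum h N (length p) (coeff p) i         ≈⟨ ∑-cong N (λ k → actPS-truncate (h k) (shifted-vanishes k) (k +ℕ B) (ℕ.+-monoʳ-≤ k L≤B) i) ⟨
      dxSum h N B (coeff p) i                  ∎
      where
      shifted-vanishes : ∀ k → VanishesFrom (k +ℕ length p) (shift^ k (coeff p))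
      shifted-vanishes k = vanishesFrom-shift^ k (coeff-vanishesFrom-length p)

  coeff-sumP-term : ∀ h N p → coeff (sumP N (λ k → term h k p)) ≋ dxSum h N (length p) (coeff p)
  coeff-sumP-term h N p i = trans (coeff-sumP N _ i) (∑-cong N (λ k → coeff-term h k p i))

  isDX⇒hasExpansion : ∀ Q → (d : IsDX Q) → HasExpansion Q (proj₁ d)
  isDX⇒hasExpansion Q (h , d) = record
    { order        = λ p → proj₁ (d p)
    ; terms-vanish = λ p k N≤k i → trans (sym (coeff-term h k p i)) (proj₁ (proj₂ (d p)) k N≤k i)
    ; expansion    = λ p i → trans (proj₂ (proj₂ (d p)) i) (coeff-sumP-term h (proj₁ (d p)) p i)
    }

  hasExpansion⇒isDX : ∀ {Q h} → HasExpansion Q h → IsDX Q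
  hasExpansion⇒isDX {Q} {h} e = h , λ p →
    order p , (λ k N≤k i → trans (coeff-term h k p i) (terms-vanish p k N≤k i))
            , (λ i → trans (expansion p i) (sym (coeff-sumP-term h (order p) p i)))
    where open HasExpansion e

  hasExpansion⇒linear : ∀ {Q h} → HasExpansion Q h → IsLinear Q
  hasExpansion⇒linear {Q} {h} e = preserves-≈P , additive , homogeneous
    where
    open HasExpansion e
    size : Poly → ℕ
    size p = order p +ℕ length p
    expand : ∀ p {M} → size p ≤ M → coeff (Q p) ≋ dxSum h M M (coeff p)
    expand p size≤M = coeff-dxSum p (ℕ.≤-trans (ℕ.m≤m+n _ _) size≤M) (ℕ.≤-trans (ℕ.m≤n+m _ _) size≤M)
    ≤-left : ∀ a b c → a ≤ a +ℕ b +ℕ c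
    ≤-left a b c = ℕ.≤-trans (ℕ.m≤m+n a b) (ℕ.m≤m+n (a +ℕ b) c)
    ≤-middle : ∀ a b c → b ≤ a +ℕ b +ℕ c
    ≤-middle a b c = ℕ.≤-trans (ℕ.m≤n+m b a) (ℕ.m≤m+n (a +ℕ b) c)
    ≤-right : ∀ a b c → c ≤ a +ℕ b +ℕ c
    ≤-right a b c = ℕ.m≤n+m c (a +ℕ b)

    preserves-≈P : ∀ p q → p ≈P q → Q p ≈P Q q
    preserves-≈P p q p≈q i = begin
      coeff (Q p) i           ≈⟨ expand p (ℕ.m≤m+n (size p) (size q)) i ⟩
      dxSum h M M (coeff p) i ≈⟨ dxSum-cong h M M p≈q i ⟩
      dxSum h M M (coeff q) i ≈⟨ expand q (ℕ.m≤n+m (size q) (size p)) i ⟨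
      coeff (Q q) i           ∎
      where M = size p +ℕ size q

    additive : ∀ p q → Q (p ⊕ q) ≈P (Q p ⊕ Q q)
    additive p q i = begin
      coeff (Q (p ⊕ q)) i                               ≈⟨ expand (p ⊕ q) (≤-right (size p) (size q) _) i ⟩
      dxSum h M M (coeff (p ⊕ q)) i                     ≈⟨ dxSum-cong h M M (coeff-⊕ p q) i ⟩
      dxSum h M M (λ n → coeff p n + coeff q n) i       ≈⟨ dxSum-+ h M M (coeff p) (coeff q) i ⟩
      dxSum h M M (coeff p) i + dxSum h M M (coeff q) i
        ≈⟨ +-cong (expand p (≤-left (size p) (size q) (size (p ⊕ q))) i)
                  (expand q (≤-middle (size p) (size q) (size (p ⊕ q))) i) ⟨
      coeff (Q p) i + coeff (Q q) i                     ≈⟨ coeff-⊕ (Q p) (Q q) i ⟨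
      coeff (Q p ⊕ Q q) i                               ∎
      where M = size p +ℕ size q +ℕ size (p ⊕ q)

    homogeneous : ∀ x p → Q (scale x p) ≈P scale x (Q p)
    homogeneous x p i = begin
      coeff (Q (scale x p)) i             ≈⟨ expand (scale x p) (ℕ.m≤n+m _ (size p)) i ⟩
      dxSum h M M (coeff (scale x p)) i   ≈⟨ dxSum-cong h M M (coeff-scale x p) i ⟩
      dxSum h M M (λ n → x * coeff p n) i ≈⟨ dxSum-* h M M x (coeff p) i ⟩
      x * dxSum h M M (coeff p) i         ≈⟨ *-congˡ (expand p (ℕ.m≤m+n (size p) _) i) ⟨
      x * coeff (Q p) i                   ≈⟨ coeff-scale x (Q p) i ⟨
      coeff (scale x (Q p)) i             ∎
      where M = size p +ℕ size (scale x p)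

  1ₚ : PowerSeries
  1ₚ zero    = 1#
  1ₚ (suc _) = 0#

  tₚ : PowerSeries
  tₚ = shift 1ₚ

  single : ℕ → PowerSeries → ℕ → PowerSeries
  single zero    f zero    = f
  single zero    f (suc m) = 0ₛ
  single (suc k) f zero    = 0ₛ
  single (suc k) f (suc m) = single k f m

  single-self : ∀ k f → single k f k ≋ f
  single-self zero    f = λ _ → refl
  single-self (suc k) f = single-self k f

  single-other : ∀ k f m → m ≢ k → single k f m ≋ 0ₛ
  single-other zero    f zero    m≢k = contradiction ≡.refl m≢k
  single-other zero    f (suc m) m≢k = λ _ → refl
  single-other (suc k) f zero    m≢k = λ _ → refl
  single-other (suc k) f (suc m) m≢k = single-other k f m (m≢k ∘ ≡.cong suc)

  hasExpansion-single : ∀ {Q} k f → (∀ p → coeff (Q p) ≋ actPS f (k +ℕ length p) (shift^ k (coeff p))) →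
                        HasExpansion Q (single k f)
  hasExpansion-single {Q} k f Q≈ = record
    { order        = λ _ → suc k
    ; terms-vanish = λ p m k<m → other-vanishes m (ℕ.>⇒≢ k<m) (length p) (coeff p)
    ; expansion    = λ p i → trans (Q≈ p i) (sym (dxSum-single (length p) (coeff p) i))
    }
    where
    other-vanishes : ∀ m → m ≢ k → ∀ B a → dxTerm (single k f) m B a ≋ 0ₛ
    other-vanishes m m≢k B a = actPS-zeroˡ (single k f m) (m +ℕ B) (shift^ m a) (λ j _ → single-other k f m m≢k j)

    dxSum-single : ∀ B a → dxSum (single k f) (suc k) B a ≋ actPS f (k +ℕ B) (shift^ k a)
    dxSum-single B a i = trans (∑-single (suc k) _ k ℕ.≤-refl (λ m m≢k → other-vanishes m m≢k B a i))
                               (actPS-congˡ (k +ℕ B) (shift^ k a) (λ j _ → single-self k f j) i)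

  actPS-1ₚ : ∀ B a → VanishesFrom B a → actPS 1ₚ B a ≋ a
  actPS-1ₚ zero    a a≈0 i = trans (∑-empty _) (sym (a≈0 i z≤n))
  actPS-1ₚ (suc B) a a≈0 i = begin
    actPS 1ₚ (suc B) a i                           ≈⟨ ∑-suc B _ ⟩
    1# * (ι 1 * a (i +ℕ 0)) + ∑[ j <ℕ B ] (0# * _) ≈⟨ +-cong (*-identityˡ _) (∑-zero B (λ j _ → zeroˡ _)) ⟩
    ι 1 * a (i +ℕ 0) + 0#                          ≈⟨ +-identityʳ _ ⟩
    ι 1 * a (i +ℕ 0)                               ≈⟨ *-cong (×-homo-1 1#) (reflexive (≡.cong a (ℕ.+-identityʳ i))) ⟩
    1# * a i                                       ≈⟨ *-identityˡ (a i) ⟩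
    a i                                            ∎

  actPS-tₚ : ∀ B a → VanishesFrom B a → actPS tₚ B a ≋ (λ i → ι (suc i) * a (suc i))
  actPS-tₚ zero          a a≈0 i = trans (∑-empty _) (sym (trans (*-congˡ (a≈0 (suc i) z≤n)) (zeroʳ _)))
  actPS-tₚ (suc zero)    a a≈0 i = begin
    actPS tₚ 1 a i                  ≈⟨ trans (∑-suc 0 _) (+-cong (zeroˡ _) (∑-empty _)) ⟩
    0# + 0#                         ≈⟨ +-identityʳ 0# ⟩
    0#                              ≈⟨ trans (*-congˡ (a≈0 (suc i) (s≤s z≤n))) (zeroʳ _) ⟨
    ι (suc i) * a (suc i)           ∎
  actPS-tₚ (suc (suc B)) a a≈0 i = begin
    actPS tₚ (suc (suc B)) a i                                          ≈⟨ trans (∑-suc (suc B) _) (+-congˡ (∑-suc B _)) ⟩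
    0# * _ + (1# * (ι (rising i 1) * a (i +ℕ 1)) + ∑[ j <ℕ B ] (0# * _))
      ≈⟨ +-cong (zeroˡ _) (+-cong (*-identityˡ _) (∑-zero B (λ j _ → zeroˡ _))) ⟩
    0# + (ι (rising i 1) * a (i +ℕ 1) + 0#)                             ≈⟨ trans (+-identityˡ _) (+-identityʳ _) ⟩
    ι (rising i 1) * a (i +ℕ 1)
      ≈⟨ *-cong (ι-cong (ℕ.*-identityʳ (suc i))) (reflexive (≡.cong a (ℕ.+-comm i 1))) ⟩
    ι (suc i) * a (suc i)                                               ∎

  idExpansion : HasExpansion (λ p → p) (single 0 1ₚ)
  idExpansion = hasExpansion-single 0 1ₚ (λ p i → sym (actPS-1ₚ (length p) (coeff p) (coeff-vanishesFrom-length p) i))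

  XExpansion : HasExpansion Xop (single 1 1ₚ)
  XExpansion = hasExpansion-single 1 1ₚ (λ p i → trans (reflexive (coeff-X^ 1 p i))
    (sym (actPS-1ₚ (suc (length p)) (shift (coeff p)) (vanishesFrom-shift^ 1 (coeff-vanishesFrom-length p)) i)))

  DExpansion : HasExpansion Dop (single 0 tₚ)
  DExpansion = hasExpansion-single 0 tₚ (λ p i →
    trans (coeff-D p i) (sym (actPS-tₚ (length p) (coeff p) (coeff-vanishesFrom-length p) i)))

  zeroExpansion : HasExpansion (λ _ → zeroP) (λ _ → 0ₛ)
  zeroExpansion = record
    { order        = λ _ → 0
    ; terms-vanish = λ p k _ → actPS-zeroˡ 0ₛ (k +ℕ length p) (shift^ k (coeff p)) (λ _ _ → refl)
    ; expansion    = λ p i → sym (∑-empty _)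
    }

  +-hasExpansion : ∀ {Q R f g} → HasExpansion Q f → HasExpansion R g →
                   HasExpansion (λ p → Q p ⊕ R p) (λ k j → f k j + g k j)
  +-hasExpansion {Q} {R} {f} {g} eQ eR = record
    { order        = N
    ; terms-vanish = vanish
    ; expansion    = λ p i → begin
        coeff (Q p ⊕ R p) i                         ≈⟨ coeff-⊕ (Q p) (R p) i ⟩
        coeff (Q p) i + coeff (R p) i
          ≈⟨ +-cong (Q.coeff-dxSum p (ℕ.m≤m+n _ _) ℕ.≤-refl i) (R.coeff-dxSum p (ℕ.m≤n+m _ _) ℕ.≤-refl i) ⟩
        dxSum f (N p) _ _ i + dxSum g (N p) _ _ i   ≈⟨ ∑-distrib-+ (N p) _ _ ⟨
        ∑[ k <ℕ N p ] (dxTerm f k _ _ i + dxTerm g k _ _ i) ≈⟨ ∑-cong (N p) (λ k → dxTerm-+ˡ f g k (length p) (coeff p) i) ⟨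
        dxSum (λ k j → f k j + g k j) (N p) (length p) (coeff p) i ∎
    }
    where
    module Q = HasExpansion eQ
    module R = HasExpansion eR
    N : Poly → ℕ
    N p = Q.order p +ℕ R.order p
    vanish : ∀ p k → N p ≤ k → dxTerm (λ k j → f k j + g k j) k (length p) (coeff p) ≋ 0ₛ
    vanish p k N≤k i = begin
      dxTerm (λ k j → f k j + g k j) k (length p) (coeff p) i        ≈⟨ dxTerm-+ˡ f g k (length p) (coeff p) i ⟩
      dxTerm f k (length p) (coeff p) i + dxTerm g k (length p) (coeff p) i
        ≈⟨ +-cong (Q.terms-vanish p k (ℕ.≤-trans (ℕ.m≤m+n _ _) N≤k) i)
                  (R.terms-vanish p k (ℕ.≤-trans (ℕ.m≤n+m _ _) N≤k) i) ⟩
      0# + 0#                                                        ≈⟨ +-identityʳ 0# ⟩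
      0#                                                             ∎

  scale-hasExpansion : ∀ x {Q f} → HasExpansion Q f → HasExpansion (λ p → scale x (Q p)) (λ k j → x * f k j)
  scale-hasExpansion x {Q} {f} eQ = record
    { order        = order
    ; terms-vanish = λ p k N≤k i →
        trans (dxTerm-*ˡ x f k (length p) (coeff p) i) (trans (*-congˡ (terms-vanish p k N≤k i)) (zeroʳ x))
    ; expansion    = λ p i → begin
        coeff (scale x (Q p)) i                           ≈⟨ coeff-scale x (Q p) i ⟩
        x * coeff (Q p) i                                 ≈⟨ *-congˡ (expansion p i) ⟩
        x * dxSum f (order p) (length p) (coeff p) i      ≈⟨ *-distribˡ-∑ (order p) x _ ⟩
        ∑[ k <ℕ order p ] (x * dxTerm f k _ _ i)          ≈⟨ ∑-cong (order p) (λ k → dxTerm-*ˡ x f k (length p) (coeff p) i) ⟨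
        dxSum (λ k j → x * f k j) (order p) (length p) (coeff p) i ∎
    }
    where open HasExpansion eQ

  X∘D≉D∘X : ¬ (1# ≈ 0#) → ¬ (∀ p → Xop (Dop p) ≈P Dop (Xop p))
  X∘D≉D∘X 1≉0 XD≈DX = 1≉0 (trans (sym (+-identityʳ 1#)) (sym (XD≈DX (1# ∷ []) 0)))

  -- Commuting X past f(D)

  derivative : PowerSeries → PowerSeries
  derivative f j = ι (suc j) * f (suc j)

  -- f(D) X = X f(D) + f′(D), read on coefficients.
  actPS-shift : ∀ f B b → VanishesFrom B b →
                actPS f (suc B) (shift b) ≋ (λ i → shift (actPS f B b) i + actPS (derivative f) B b i)
  actPS-shift f B b b≈0 zero = trans (∑-suc B _) (+-cong (x*[y*0]≈0 _ _ refl) (∑-cong B at-zero))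
    where
    at-zero : ∀ j → f (suc j) * (ι (rising 0 (suc j)) * b j) ≈ derivative f j * (ι (rising 0 j) * b j)
    at-zero j = trans (*-congˡ (*-congʳ (trans (ι-cong (rising-sucʳ 0 j)) (×1-homo-* (rising 0 j) (suc j)))))
                      (solve 4 (λ f r s x → f :* ((r :* s) :* x) := (s :* f) :* (r :* x)) refl _ _ _ _)
  actPS-shift f B b b≈0 (suc i) = begin
    actPS f (suc B) (shift b) (suc i)                                   ≈⟨ ∑-suc B _ ⟩
    f 0 * (ι 1 * b (i +ℕ 0)) + ∑[ j <ℕ B ] (f (suc j) * (ι (rising (suc i) (suc j)) * b (i +ℕ suc j)))
      ≈⟨ +-congˡ (trans (∑-cong B pascal) (∑-distrib-+ B _ _)) ⟩
    f 0 * (ι 1 * b (i +ℕ 0)) + (∑[ j <ℕ B ] (f (suc j) * (ι (rising i (suc j)) * b (i +ℕ suc j))) + D′)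
      ≈⟨ +-assoc _ _ _ ⟨
    f 0 * (ι 1 * b (i +ℕ 0)) + ∑[ j <ℕ B ] (f (suc j) * (ι (rising i (suc j)) * b (i +ℕ suc j))) + D′
      ≈⟨ +-congʳ (∑-suc B (λ j → f j * (ι (rising i j) * b (i +ℕ j)))) ⟨
    actPS f (suc B) b i + actPS (derivative f) B b (suc i)              ≈⟨ +-congʳ (actPS-truncate f b≈0 (suc B) (ℕ.n≤1+n B) i) ⟩
    actPS f B b i + actPS (derivative f) B b (suc i)                    ∎
    where
    D′ = actPS (derivative f) B b (suc i)
    pascal : ∀ j → f (suc j) * (ι (rising (suc i) (suc j)) * b (i +ℕ suc j)) ≈
                   f (suc j) * (ι (rising i (suc j)) * b (i +ℕ suc j)) + derivative f j * (ι (rising (suc i) j) * b (suc i +ℕ j))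
    pascal j = begin
      f (suc j) * (ι (rising (suc i) (suc j)) * b (i +ℕ suc j))
        ≈⟨ *-congˡ (*-cong ι-pascal (reflexive (≡.cong b (ℕ.+-suc i j)))) ⟩
      f (suc j) * ((ι (rising i (suc j)) + ι (suc j) * ι (rising (suc i) j)) * b (suc i +ℕ j))
        ≈⟨ solve 5 (λ f A s R x → f :* ((A :+ s :* R) :* x) := f :* (A :* x) :+ (s :* f) :* (R :* x)) refl _ _ _ _ _ ⟩
      f (suc j) * (ι (rising i (suc j)) * b (suc i +ℕ j)) + derivative f j * (ι (rising (suc i) j) * b (suc i +ℕ j))
        ≈⟨ +-congʳ (*-congˡ (*-congˡ (reflexive (≡.cong b (≡.sym (ℕ.+-suc i j)))))) ⟩
      f (suc j) * (ι (rising i (suc j)) * b (i +ℕ suc j)) + derivative f j * (ι (rising (suc i) j) * b (suc i +ℕ j)) ∎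
      where
      ι-pascal : ι (rising (suc i) (suc j)) ≈ ι (rising i (suc j)) + ι (suc j) * ι (rising (suc i) j)
      ι-pascal = trans (ι-cong (rising-pascal i j))
        (trans (×-homo-+ 1# (rising i (suc j)) (suc j *ℕ rising (suc i) j)) (+-congˡ (×1-homo-* (suc j) (rising (suc i) j))))

  infixl 7 _⊛_
  _⊛_ : PowerSeries → PowerSeries → PowerSeries
  (f ⊛ g) n = ∑[ a <ℕ suc n ] (f a * shift^ a g n)

  shift^-below : ∀ k a n → n < k → shift^ k a n ≡ 0#
  shift^-below (suc k) a zero    _         = ≡.refl
  shift^-below (suc k) a (suc n) (s≤s n<k) = shift^-below k a n n<k

  shift^-above : ∀ k a n → k ≤ n → shift^ k a n ≡ a (n ∸ℕ k)
  shift^-above zero    a n       _         = ≡.refl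
  shift^-above (suc k) a (suc n) (s≤s k≤n) = shift^-above k a n k≤n

  ⊛-vanishes : ∀ f g n → (∀ a b → a +ℕ b ≡ n → f a * g b ≈ 0#) → (f ⊛ g) n ≈ 0#
  ⊛-vanishes f g n fg≈0 = ∑-zero (suc n) λ a a<1+n → let a≤n = s≤s⁻¹ a<1+n in
    trans (*-congˡ (reflexive (shift^-above a g n a≤n))) (fg≈0 a (n ∸ℕ a) (ℕ.m+[n∸m]≡n a≤n))

  ∑-shift^ : ∀ k g B (C : Seq) → ∑[ n <ℕ k +ℕ B ] (shift^ k g n * C n) ≈ ∑[ l <ℕ B ] (g l * C (k +ℕ l))
  ∑-shift^ zero    g B C = refl
  ∑-shift^ (suc k) g B C =
    trans (∑-suc (k +ℕ B) _) (trans (+-congʳ (zeroˡ _)) (trans (+-identityˡ _) (∑-shift^ k g B (C ∘ suc))))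

  actPS-⊛ : ∀ f g B a → VanishesFrom B a → actPS f B (actPS g B a) ≋ actPS (f ⊛ g) B a
  actPS-⊛ f g B a a≈0 i = begin
    ∑[ j <ℕ B ] (f j * (ι (rising i j) * ∑[ l <ℕ B ] (g l * (ι (rising (i +ℕ j) l) * a (i +ℕ j +ℕ l)))))
      ≈⟨ ∑-cong B (λ j → *-congˡ (pull-rising j)) ⟩
    ∑[ j <ℕ B ] (f j * ∑[ l <ℕ B ] (g l * C (j +ℕ l)))
      ≈⟨ ∑-cong B (λ j → *-congˡ (sym (∑-shift^ j g B C))) ⟩
    ∑[ j <ℕ B ] (f j * ∑[ n <ℕ j +ℕ B ] (shift^ j g n * C n))
      ≈⟨ ∑-cong B (λ j → *-congˡ (∑-truncate _ (λ n B≤n → trans (*-congˡ (C≈0 n B≤n)) (zeroʳ _)) (j +ℕ B) (ℕ.m≤n+m B j))) ⟩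
    ∑[ j <ℕ B ] (f j * ∑[ n <ℕ B ] (shift^ j g n * C n))
      ≈⟨ ∑-cong B (λ j → *-distribˡ-∑ B (f j) _) ⟩
    ∑[ j <ℕ B ] ∑[ n <ℕ B ] (f j * (shift^ j g n * C n))
      ≈⟨ ∑-swap B B _ ⟩
    ∑[ n <ℕ B ] ∑[ j <ℕ B ] (f j * (shift^ j g n * C n))
      ≈⟨ ∑-cong< B (λ n n<B → ∑-truncate _ (λ j n<j → x*[0*z]≈0 _ _ (reflexive (shift^-below j g n n<j))) B n<B) ⟩
    ∑[ n <ℕ B ] ∑[ j <ℕ suc n ] (f j * (shift^ j g n * C n))
      ≈⟨ ∑-cong B (λ n → trans (∑-cong (suc n) (λ j → sym (*-assoc _ _ _))) (sym (*-distribʳ-∑ (suc n) (C n) _))) ⟩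
    ∑[ n <ℕ B ] ((f ⊛ g) n * C n) ∎
    where
    C : Seq
    C n = ι (rising i n) * a (i +ℕ n)
    C≈0 : ∀ n → B ≤ n → C n ≈ 0#
    C≈0 n B≤n = trans (*-congˡ (a≈0 (i +ℕ n) (ℕ.≤-trans B≤n (ℕ.m≤n+m n i)))) (zeroʳ _)
    pull-rising : ∀ j → ι (rising i j) * ∑[ l <ℕ B ] (g l * (ι (rising (i +ℕ j) l) * a (i +ℕ j +ℕ l))) ≈
                        ∑[ l <ℕ B ] (g l * C (j +ℕ l))
    pull-rising j = trans (*-distribˡ-∑ B _ _) (∑-cong B λ l →
      trans (solve 4 (λ x g y z → x :* (g :* (y :* z)) := g :* ((x :* y) :* z)) refl _ _ _ _)
            (*-congˡ (*-cong (trans (sym (×1-homo-* (rising i j) (rising (i +ℕ j) l))) (ι-cong (rising-+ i j l)))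
                             (reflexive (≡.cong a (ℕ.+-assoc i j l))))))

  actPS-dxSum : ∀ f G N L a → VanishesFrom L a → ∀ B → N +ℕ L ≤ B →
                actPS f B (dxSum G N L a) ≋ dxSum (λ m → f ⊛ G m) N L a
  actPS-dxSum f G N L a a≈0 B N+L≤B i = trans (actPS-∑ʳ N f B (λ m → dxTerm G m L a) i) (∑-cong< N composeTerm)
    where
    composeTerm : ∀ m → m < N → actPS f B (dxTerm G m L a) i ≈ dxTerm (λ m → f ⊛ G m) m L a i
    composeTerm m m<N = begin
      actPS f B (actPS (G m) (m +ℕ L) (shift^ m a)) i ≈⟨ actPS-cong f B (λ n → sym (actPS-truncate (G m) c≈0 B m+L≤B n)) i ⟩
      actPS f B (actPS (G m) B (shift^ m a)) i        ≈⟨ actPS-⊛ f (G m) B (shift^ m a) (vanishesFrom-mono c≈0 m+L≤B) i ⟩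
      actPS (f ⊛ G m) B (shift^ m a) i                ≈⟨ actPS-truncate (f ⊛ G m) c≈0 B m+L≤B i ⟩
      actPS (f ⊛ G m) (m +ℕ L) (shift^ m a) i         ∎
      where
      c≈0 : VanishesFrom (m +ℕ L) (shift^ m a)
      c≈0 = vanishesFrom-shift^ m a≈0
      m+L≤B : m +ℕ L ≤ B
      m+L≤B = ℕ.≤-trans (ℕ.+-monoˡ-≤ L (ℕ.<⇒≤ m<N)) N+L≤B

  -- Convergence and composition

  -- Discrete convergence of ∑ h_k(D) X^k on polynomials of length L, read on the
  -- coefficients: h_k(D) X^k p only involves h_k j for j < k + L.
  Convergent : (ℕ → PowerSeries) → Set ℓ
  Convergent h = ∀ L → Σ ℕ λ N → ∀ k → N ≤ k → ∀ j → j < k +ℕ L → h k j ≈ 0#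

  -- t^(m ∸ r) divides h m.
  DivisibleByT^ : (ℕ → PowerSeries) → ℕ → Set ℓ
  DivisibleByT^ h r = ∀ m j → j +ℕ r < m → h m j ≈ 0#

  convergent⇒divisibleByT^ : ∀ {h} → (conv : Convergent h) → DivisibleByT^ h (proj₁ (conv 0))
  convergent⇒divisibleByT^ conv m j j+r<m = proj₂ (conv 0) m (ℕ.≤-trans (ℕ.m≤n+m _ j) (ℕ.<⇒≤ j+r<m)) j
    (≡.subst (j <_) (≡.sym (ℕ.+-identityʳ m)) (ℕ.≤-<-trans (ℕ.m≤m+n j _) j+r<m))

  convergent⇒terms-vanish : ∀ {h} → Convergent h → ∀ L → Σ ℕ λ N → ∀ k → N ≤ k → ∀ a → dxTerm h k L a ≋ 0ₛ
  convergent⇒terms-vanish {h} conv L =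
    proj₁ (conv L) , λ k N≤k a → actPS-zeroˡ (h k) (k +ℕ L) (shift^ k a) (proj₂ (conv L) k N≤k)

  previous : (ℕ → PowerSeries) → ℕ → PowerSeries
  previous h zero    = 0ₛ
  previous h (suc m) = h m

  -- X h(D) = h(D) X − h′(D), so X ∑ h_m(D) X^m = ∑ (h_{m−1} − h_m′)(D) X^m.
  mulX : (ℕ → PowerSeries) → ℕ → PowerSeries
  mulX h m j = previous h m j - derivative (h m) j

  mulX^ : (ℕ → PowerSeries) → ℕ → ℕ → PowerSeries
  mulX^ h zero    = h
  mulX^ h (suc k) = mulX (mulX^ h k)

  mulX-convergent : ∀ {h} → Convergent h → Convergent (mulX h)
  mulX-convergent {h} conv L = suc N , vanish
    where
    N = proj₁ (conv (suc L))
    vanish : ∀ k → suc N ≤ k → ∀ j → j < k +ℕ L → mulX h k j ≈ 0#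
    vanish (suc m) (s≤s N≤m) j j<1+m+L = trans
      (+-cong (proj₂ (conv (suc L)) m N≤m j j<m+1+L)
              (-‿cong (trans (*-congˡ (proj₂ (conv (suc L)) (suc m) (ℕ.m≤n⇒m≤1+n N≤m) (suc j) (s≤s j<m+1+L))) (zeroʳ _))))
      (-‿inverseʳ 0#)
      where
      j<m+1+L : j < m +ℕ suc L
      j<m+1+L = ≡.subst (j <_) (≡.sym (ℕ.+-suc m L)) j<1+m+L

  mulX-divisibleByT^ : ∀ {h r} → DivisibleByT^ h r → DivisibleByT^ (mulX h) (suc r)
  mulX-divisibleByT^ {h} {r} div (suc m) j j+1+r<1+m = trans
    (+-cong (div m j (ℕ.≤-pred j+r+1<1+m))
            (-‿cong (trans (*-congˡ (div (suc m) (suc j) j+r+1<1+m)) (zeroʳ _))))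
    (-‿inverseʳ 0#)
    where
    j+r+1<1+m : suc j +ℕ r < suc m
    j+r+1<1+m = ≡.subst (_< suc m) (ℕ.+-suc j r) j+1+r<1+m

  mulX^-convergent : ∀ {h} → Convergent h → ∀ k → Convergent (mulX^ h k)
  mulX^-convergent conv zero    = conv
  mulX^-convergent conv (suc k) = mulX-convergent (mulX^-convergent conv k)

  mulX^-divisibleByT^ : ∀ {h r} → DivisibleByT^ h r → ∀ k → DivisibleByT^ (mulX^ h k) (k +ℕ r)
  mulX^-divisibleByT^ div zero    = div
  mulX^-divisibleByT^ div (suc k) = mulX-divisibleByT^ (mulX^-divisibleByT^ div k)

  Represents : (ℕ → PowerSeries) → ℕ → Seq → Seq → Set ℓ
  Represents h B a b = Σ ℕ λ N₀ → ∀ N → N₀ ≤ N → b ≋ dxSum h N B a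

  shift-represents : ∀ {h B a b} → Convergent h → VanishesFrom B a → Represents h B a b →
                     Represents (mulX h) B a (shift b)
  shift-represents {h} {B} {a} {b} conv a≈0 (N₀ , b≋) = suc (N₀ +ℕ M) , represents
    where
    M = proj₁ (conv (suc B))
    c≈0 : ∀ m → VanishesFrom (m +ℕ B) (shift^ m a)
    c≈0 m = vanishesFrom-shift^ m a≈0
    P D′ : ℕ → ℕ → Carrier
    P  i m = actPS (previous h m) (m +ℕ B) (shift^ m a) i
    D′ i m = actPS (derivative (h m)) (m +ℕ B) (shift^ m a) i
    first-vanishes : ∀ N i → ∑< (suc N) (P i) ≈ ∑[ m <ℕ N ] P i (suc m)
    first-vanishes N i = trans (∑-suc N (P i)) (trans (+-congʳ (actPS-zeroˡ 0ₛ B a (λ _ _ → refl) i)) (+-identityˡ _))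
    last-vanishes : ∀ N → M ≤ N → ∀ i → ∑< (suc N) (D′ i) ≈ ∑< N (D′ i)
    last-vanishes N M≤N i = trans (∑-init-last N (D′ i)) (trans (+-congˡ D′N≈0) (+-identityʳ _))
      where
      D′N≈0 : D′ i N ≈ 0#
      D′N≈0 = actPS-zeroˡ (derivative (h N)) (N +ℕ B) (shift^ N a)
        (λ j j<N+B → trans (*-congˡ (proj₂ (conv (suc B)) N M≤N (suc j) (≡.subst (suc j <_) (≡.sym (ℕ.+-suc N B)) (s≤s j<N+B))))
                           (zeroʳ _)) i
    represents : ∀ N → suc (N₀ +ℕ M) ≤ N → shift b ≋ dxSum (mulX h) N B a
    represents (suc N) (s≤s N₀+M≤N) i = begin
      shift b i                             ≈⟨ shift-cong (b≋ N (ℕ.≤-trans (ℕ.m≤m+n N₀ M) N₀+M≤N)) i ⟩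
      shift (dxSum h N B a) i               ≈⟨ shift-∑ N (λ m → dxTerm h m B a) i ⟩
      ∑[ m <ℕ N ] shift (dxTerm h m B a) i
        ≈⟨ ∑-cong N (λ m → x+z≈y⇒x≈y-z (sym (actPS-shift (h m) (m +ℕ B) (shift^ m a) (c≈0 m) i))) ⟩
      ∑[ m <ℕ N ] (P i (suc m) - D′ i m)    ≈⟨ ∑-distrib-minus N _ _ ⟩
      ∑[ m <ℕ N ] P i (suc m) - ∑< N (D′ i)
        ≈⟨ +-cong (sym (first-vanishes N i)) (-‿cong (sym (last-vanishes N (ℕ.≤-trans (ℕ.m≤n+m M N₀) N₀+M≤N) i))) ⟩
      ∑< (suc N) (P i) - ∑< (suc N) (D′ i)  ≈⟨ ∑-distrib-minus (suc N) _ _ ⟨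
      ∑[ m <ℕ suc N ] (P i m - D′ i m)
        ≈⟨ ∑-cong (suc N) (λ m → actPS-minusˡ (previous h m) (derivative (h m)) (m +ℕ B) (shift^ m a) i) ⟨
      dxSum (mulX h) (suc N) B a i          ∎

  shift^-represents : ∀ {h B a b} → Convergent h → VanishesFrom B a → Represents h B a b →
                      ∀ k → Represents (mulX^ h k) B a (shift^ k b)
  shift^-represents conv a≈0 rep zero    = rep
  shift^-represents conv a≈0 rep (suc k) =
    shift-represents (mulX^-convergent conv k) a≈0 (shift^-represents conv a≈0 rep k)

  monomial : ℕ → Poly
  monomial M = iter M Xop (1# ∷ [])

  coeff-monomial-self : ∀ M → coeff (monomial M) M ≡ 1#
  coeff-monomial-self zero    = ≡.refl
  coeff-monomial-self (suc M) = coeff-monomial-self M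

  coeff-monomial-other : ∀ M n → n ≢ M → coeff (monomial M) n ≈ 0#
  coeff-monomial-other zero    zero    n≢M = contradiction ≡.refl n≢M
  coeff-monomial-other zero    (suc n) n≢M = refl
  coeff-monomial-other (suc M) zero    n≢M = refl
  coeff-monomial-other (suc M) (suc n) n≢M = coeff-monomial-other M n (n≢M ∘ ≡.cong suc)

  shift^-monomial : ∀ k L n → shift^ k (coeff (monomial L)) n ≡ coeff (monomial (k +ℕ L)) n
  shift^-monomial k L n = ≡.trans (≡.sym (coeff-X^ k (monomial L) n)) (≡.cong (λ q → coeff q n) (iter-+ k))
    where
    iter-+ : ∀ k → iter k Xop (monomial L) ≡ monomial (k +ℕ L)
    iter-+ zero    = ≡.refl
    iter-+ (suc k) = ≡.cong Xop (iter-+ k)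

  actPS-at-unit : ∀ f B a M j → a M ≈ 1# → (∀ n → n ≢ M → a n ≈ 0#) → j ≤ M → j < B →
                  actPS f B a (M ∸ℕ j) ≈ f j * ι (rising (M ∸ℕ j) j)
  actPS-at-unit f B a M j aM≈1 a≈0 j≤M j<B = begin
    actPS f B a i                  ≈⟨ ∑-single B _ j j<B others ⟩
    f j * (ι (rising i j) * a (i +ℕ j)) ≈⟨ *-congˡ (trans (*-congˡ (trans (reflexive (≡.cong a i+j≡M)) aM≈1)) (*-identityʳ _)) ⟩
    f j * ι (rising i j)           ∎
    where
    i = M ∸ℕ j
    i+j≡M : i +ℕ j ≡ M
    i+j≡M = ℕ.m∸n+n≡m j≤M
    others : ∀ j′ → j′ ≢ j → f j′ * (ι (rising i j′) * a (i +ℕ j′)) ≈ 0#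
    others j′ j′≢j =
      x*[y*0]≈0 _ _ (a≈0 (i +ℕ j′) (λ i+j′≡M → j′≢j (ℕ.+-cancelˡ-≡ i j′ j (≡.trans i+j′≡M (≡.sym i+j≡M)))))

  module _ (isField : IsField K) (charZero : CharZero K) where

    ι-cancelʳ : ∀ x n → .{{NonZero n}} → x * ι n ≈ 0# → x ≈ 0#
    ι-cancelʳ x (suc n) x*n≈0 = begin
      x                   ≈⟨ *-identityʳ x ⟨
      x * 1#              ≈⟨ *-congˡ n*n⁻¹≈1 ⟨
      x * (ι (suc n) * y) ≈⟨ *-assoc _ _ _ ⟨
      x * ι (suc n) * y   ≈⟨ *-congʳ x*n≈0 ⟩
      0# * y              ≈⟨ zeroˡ y ⟩
      0#                  ∎
      where
      y = proj₁ (proj₂ isField (ι (suc n)) (charZero n))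
      n*n⁻¹≈1 = proj₂ (proj₂ isField (ι (suc n)) (charZero n))

    -- Testing the expansion on x^L recovers each h_k j with j ≤ k + L, up to a
    -- nonzero factor rising i j; this is where characteristic zero is used.
    hasExpansion⇒convergent : ∀ {Q h} → HasExpansion Q h → Convergent h
    hasExpansion⇒convergent {Q} {h} e L = order (monomial L) , vanish
      where
      open HasExpansion e
      vanish : ∀ k → order (monomial L) ≤ k → ∀ j → j < k +ℕ L → h k j ≈ 0#
      vanish k order≤k j j<k+L = ι-cancelʳ (h k j) (rising i j) {{rising-nonZero i j}} (begin
        h k j * ι (rising i j)      ≈⟨ actPS-at-unit (h k) _ a (k +ℕ L) j a[k+L]≈1 a≈0 (ℕ.<⇒≤ j<k+L) j<B ⟨
        actPS (h k) _ a i           ≈⟨ terms-vanish (monomial L) k order≤k i ⟩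
        0#                          ∎)
        where
        a = shift^ k (coeff (monomial L))
        i = k +ℕ L ∸ℕ j
        j<B : j < k +ℕ length (monomial L)
        j<B = ℕ.<-≤-trans j<k+L (ℕ.+-monoʳ-≤ k (≡.subst (L ≤_) (≡.sym (length-X^ L (1# ∷ []))) (ℕ.m≤m+n L 1)))
        a[k+L]≈1 : a (k +ℕ L) ≈ 1#
        a[k+L]≈1 = reflexive (≡.trans (shift^-monomial k L (k +ℕ L)) (coeff-monomial-self (k +ℕ L)))
        a≈0 : ∀ n → n ≢ k +ℕ L → a n ≈ 0#
        a≈0 n n≢k+L = trans (reflexive (shift^-monomial k L n)) (coeff-monomial-other (k +ℕ L) n n≢k+L)

    module Composition {Q R f g} (eQ : HasExpansion Q f) (eR : HasExpansion R g) where

      f-convergent : Convergent f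
      f-convergent = hasExpansion⇒convergent eQ

      g-convergent : Convergent g
      g-convergent = hasExpansion⇒convergent eR

      ord : ℕ → ℕ
      ord L = proj₁ (f-convergent L)

      r : ℕ
      r = proj₁ (g-convergent 0)

      G : ℕ → ℕ → PowerSeries
      G = mulX^ g

      G-convergent : ∀ k → Convergent (G k)
      G-convergent = mulX^-convergent g-convergent

      G-divisibleByT^ : ∀ k → DivisibleByT^ (G k) (k +ℕ r)
      G-divisibleByT^ = mulX^-divisibleByT^ (convergent⇒divisibleByT^ g-convergent)

      -- Q R = ∑_k f_k(D) X^k R = ∑_k ∑_m (f_k G_{k,m})(D) X^m, and only k < ord (j + 1)
      -- contribute to the coefficient of t^j.
      composite : ℕ → PowerSeries
      composite m j = ∑[ k <ℕ ord (suc j) ] (f k ⊛ G k m) j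

      f⊛G-vanishes-beyond-ord : ∀ k j → ord (suc j) ≤ k → ∀ m → (f k ⊛ G k m) j ≈ 0#
      f⊛G-vanishes-beyond-ord k j ord≤k m = ⊛-vanishes (f k) (G k m) j λ a b a+b≡j →
        trans (*-congʳ (proj₂ (f-convergent (suc j)) k ord≤k a (a<k+1+j a+b≡j))) (zeroˡ _)
        where
        a<k+1+j : ∀ {a b} → a +ℕ b ≡ j → a < k +ℕ suc j
        a<k+1+j {a} {b} a+b≡j = ℕ.≤-trans (s≤s (≡.subst (a ≤_) a+b≡j (ℕ.m≤m+n a b))) (ℕ.m≤n+m (suc j) k)

      -- f_k a = 0 for a < k + L + r by convergence of f, and G_{k,m} b = 0 for b + k + r < m
      -- by divisibility; when a + b = j < m + L one of the two applies.
      f⊛G-vanishes-large : ∀ L k → ord (L +ℕ r) ≤ k → ∀ m j → j < m +ℕ L → (f k ⊛ G k m) j ≈ 0#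
      f⊛G-vanishes-large L k ord≤k m j j<m+L = ⊛-vanishes (f k) (G k m) j vanish
        where
        b+k+r<m : ∀ a b → a +ℕ b ≡ j → k +ℕ (L +ℕ r) ≤ a → b +ℕ (k +ℕ r) < m
        b+k+r<m a b a+b≡j k+L+r≤a = ℕ.+-cancelʳ-< L (b +ℕ (k +ℕ r)) m
          (≡.subst (_< m +ℕ L) (≡.sym (b+[k+r]+L≡b+[k+[L+r]] b k L r))
            (ℕ.≤-<-trans (ℕ.+-monoʳ-≤ b k+L+r≤a) (≡.subst (_< m +ℕ L) (≡.trans (≡.sym a+b≡j) (ℕ.+-comm a b)) j<m+L)))
        vanish : ∀ a b → a +ℕ b ≡ j → f k a * G k m b ≈ 0#
        vanish a b a+b≡j with a ℕ.<? k +ℕ (L +ℕ r)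
        ... | yes a<k+L+r = trans (*-congʳ (proj₂ (f-convergent (L +ℕ r)) k ord≤k a a<k+L+r)) (zeroˡ _)
        ... | no  a≮k+L+r = trans (*-congˡ (G-divisibleByT^ k m b (b+k+r<m a b a+b≡j (ℕ.≮⇒≥ a≮k+L+r)))) (zeroʳ _)

      composite-truncate : ∀ L N m j → ord (L +ℕ r) ≤ N → j < m +ℕ L → ∑[ k <ℕ N ] (f k ⊛ G k m) j ≈ composite m j
      composite-truncate L N m j ord≤N j<m+L =
        trans (∑-truncate _ late N ord≤N) (∑-truncate₂ _ late (λ k ord≤k → f⊛G-vanishes-beyond-ord k j ord≤k m))
        where
        late : ∀ k → ord (L +ℕ r) ≤ k → (f k ⊛ G k m) j ≈ 0#
        late k ord≤k = f⊛G-vanishes-large L k ord≤k m j j<m+L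

      composite-convergent : Convergent composite
      composite-convergent L = max< k₀ (λ k → proj₁ (G-convergent k L)) , vanish
        where
        k₀ = ord (L +ℕ r)
        vanish : ∀ m → max< k₀ (λ k → proj₁ (G-convergent k L)) ≤ m → ∀ j → j < m +ℕ L → composite m j ≈ 0#
        vanish m max≤m j j<m+L = ∑-zero (ord (suc j)) (λ k _ → term-vanishes k)
          where
          term-vanishes : ∀ k → (f k ⊛ G k m) j ≈ 0#
          term-vanishes k with k ℕ.<? k₀
          ... | no  k≮k₀ = f⊛G-vanishes-large L k (ℕ.≮⇒≥ k≮k₀) m j j<m+L
          ... | yes k<k₀ = ⊛-vanishes (f k) (G k m) j λ a b a+b≡j → trans
                  (*-congˡ (proj₂ (G-convergent k L) m (ℕ.≤-trans (≤-max< k₀ _ k k<k₀) max≤m) b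
                             (ℕ.≤-<-trans (≡.subst (b ≤_) a+b≡j (ℕ.m≤n+m b a)) j<m+L)))
                  (zeroʳ _)

      X^R-represents : ∀ k p → Represents (G k) (length p) (coeff p) (shift^ k (coeff (R p)))
      X^R-represents k p = shift^-represents g-convergent (coeff-vanishesFrom-length p)
        (HasExpansion.order eR p , λ N order≤N → HasExpansion.coeff-dxSum eR p order≤N ℕ.≤-refl) k

      ∘-hasExpansion : HasExpansion (λ p → Q (R p)) composite
      ∘-hasExpansion = record
        { order        = order
        ; terms-vanish = λ p m order≤m → proj₂ (convergent⇒terms-vanish composite-convergent (length p)) m
                                           (ℕ.≤-trans (ℕ.m≤n+m _ _) order≤m) (coeff p)
        ; expansion    = expansion
        }
        where
        module Q = HasExpansion eQ
        N₁ : Poly → ℕ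
        N₁ p = Q.order (R p) +ℕ ord (length p +ℕ r)
        order : Poly → ℕ
        order p = max< (N₁ p) (λ k → proj₁ (X^R-represents k p)) +ℕ proj₁ (composite-convergent (length p))

        expansion : ∀ p → coeff (Q (R p)) ≋ dxSum composite (order p) (length p) (coeff p)
        expansion p i = begin
          coeff (Q (R p)) i
            ≈⟨ Q.coeff-dxSum (R p) (ℕ.m≤m+n _ _) (ℕ.m≤m+n _ _) i ⟩
          ∑[ k <ℕ N₁ p ] actPS (f k) (k +ℕ B) (shift^ k (coeff (R p))) i
            ≈⟨ ∑-cong< (N₁ p) (λ k k<N₁ → actPS-cong (f k) (k +ℕ B) (X^R k k<N₁) i) ⟩
          ∑[ k <ℕ N₁ p ] actPS (f k) (k +ℕ B) (dxSum (G k) N L a) i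
            ≈⟨ ∑-cong (N₁ p) (λ k → actPS-dxSum (f k) (G k) N L a a≈0 (k +ℕ B) (N+L≤k+B k) i) ⟩
          ∑[ k <ℕ N₁ p ] ∑[ m <ℕ N ] actPS (f k ⊛ G k m) (m +ℕ L) (shift^ m a) i
            ≈⟨ ∑-swap (N₁ p) N _ ⟩
          ∑[ m <ℕ N ] ∑[ k <ℕ N₁ p ] actPS (f k ⊛ G k m) (m +ℕ L) (shift^ m a) i
            ≈⟨ ∑-cong N (λ m → actPS-∑ˡ (N₁ p) (λ k → f k ⊛ G k m) (m +ℕ L) (shift^ m a) i) ⟨
          ∑[ m <ℕ N ] actPS (λ j → ∑[ k <ℕ N₁ p ] (f k ⊛ G k m) j) (m +ℕ L) (shift^ m a) i
            ≈⟨ ∑-cong N (λ m → actPS-congˡ (m +ℕ L) (shift^ m a) (λ j → composite-truncate L (N₁ p) m j (ℕ.m≤n+m _ _)) i) ⟩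
          dxSum composite N L a i ∎
          where
          L = length p
          a = coeff p
          N = order p
          B = length (R p) +ℕ (N +ℕ L)
          a≈0 = coeff-vanishesFrom-length p
          N+L≤k+B : ∀ k → N +ℕ L ≤ k +ℕ B
          N+L≤k+B k = ℕ.≤-trans (ℕ.m≤n+m (N +ℕ L) (length (R p))) (ℕ.m≤n+m B k)
          X^R : ∀ k → k < N₁ p → shift^ k (coeff (R p)) ≋ dxSum (G k) N L a
          X^R k k<N₁ = proj₂ (X^R-represents k p) N (ℕ.≤-trans (≤-max< (N₁ p) _ k k<N₁) (ℕ.m≤m+n _ _))

mainTheorem10 : ∀ {c ℓ} (K : CommutativeRing c ℓ) → IsField K → CharZero K →
    let open CommutativeRing K using (Carrier)
        open DX K
    in (∀ Q → IsDX Q → IsLinear Q)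
       × IsDX (λ p → p)
       × IsDX (λ p → zeroP)
       × (∀ Q R → IsDX Q → IsDX R → IsDX (λ p → Q p ⊕ R p))
       × (∀ (a : Carrier) Q → IsDX Q → IsDX (λ p → scale a (Q p)))
       × (∀ Q R → IsDX Q → IsDX R → IsDX (λ p → Q (R p)))
       × Σ (Poly → Poly) (λ Q → Σ (Poly → Poly) (λ R →
           IsDX Q × IsDX R × ¬ (∀ p → Q (R p) ≈P R (Q p))))
mainTheorem10 K isField charZero =
    (λ Q dQ → hasExpansion⇒linear (isDX⇒hasExpansion Q dQ))
  , hasExpansion⇒isDX idExpansion
  , hasExpansion⇒isDX zeroExpansion
  , (λ Q R dQ dR → hasExpansion⇒isDX (+-hasExpansion (isDX⇒hasExpansion Q dQ) (isDX⇒hasExpansion R dR)))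
  , (λ x Q dQ → hasExpansion⇒isDX (scale-hasExpansion x (isDX⇒hasExpansion Q dQ)))
  , (λ Q R dQ dR → hasExpansion⇒isDX
       (Composition.∘-hasExpansion isField charZero (isDX⇒hasExpansion Q dQ) (isDX⇒hasExpansion R dR)))
  , Xop , Dop , hasExpansion⇒isDX XExpansion , hasExpansion⇒isDX DExpansion , X∘D≉D∘X (proj₁ isField)
  where
  open DX K
  open DXOperators K
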